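{- Let $G$ be an $r$-regular graph with $n$ vertices and $m$ edges, and let $q_1\le q_2\le\dots\le q_n$ be the signless Laplacian eigenvalues of $G$ (so $q_n=2r$). Then \[ f(\lambda,G^{10+})=[\lambda^2-(r+2n)\lambda+4n-4](\lambda-2)^{m-n}\prod_{i=1}^{n-1}[(\lambda-r-n+2)(\lambda-2)-q_i]. \]
   Context: All graphs are finite and simple. For a graph $H$, $Q(H)=D(H)+A(H)$ is its signless Laplacian matrix ($D(H)$ the diagonal degree matrix, $A(H)$ the adjacency matrix), and $f(\lambda,H)=\det(\lambda I-Q(H))$ is its signless Laplacian characteristic polynomial. The signless Laplacian eigenvalues of $G$ are the eigenvalues of $Q(G)$ listed with multiplicity in non-decreasing order; since $G$ is $r$-regular the largest is $2r$, and $2m=rn$. For a graph $H$: $H^0$ is the edgeless graph on $V(H)$, $H^1$ the complete graph on $V(H)$, $H^+=H$, and $H^-$ the complement of $H$. The line graph $G^l$ has vertex set $E(G)$, two vertices adjacent iff the corresponding edges of $G$ share an endpoint. For $x,y,z\in\{0,1,+,-\}$, the $xyz$-transformation $G^{xyz}$ is the graph with vertex set $V(G)\cup E(G)$ (disjoint) and edge set $E(G^x)\cup E((G^l)^y)\cup E(W)$, where $W$ has vertex set $V(G)\cup E(G)$ and its edges are: all pairs $ve$ ($v\in V(G)$, $e\in E(G)$) with $v$ incident to $e$ if $z=+$; all pairs $ve$ with $v$ not incident to $e$ if $z=-$; no edges if $z=0$; all pairs $ve$ with $v\in V(G)$, $e\in E(G)$ if $z=1$. -}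

module Defs where

open import Data.Bool using (Bool; true; false; if_then_else_; _∧_; _∨_; not)
open import Data.Nat as ℕ using (ℕ; zero; suc; _<ᵇ_)
open import Data.Fin as Fin using (Fin; zero; suc; toℕ; punchIn; splitAt)
open import Data.Fin.Properties using () renaming (_≟_ to _≟F_)
open import Data.Integer as ℤ using (ℤ; +_; _-_; _*_; _+_; -_)
open import Data.List using (List; []; _∷_; [_]; concatMap; allFin; length; lookup)
open import Data.Product using (_×_; _,_)
open import Data.Sum using (inj₁; inj₂)
open import Relation.Binary.PropositionalEquality using (_≡_)
open import Relation.Nullary.Decidable using (⌊_⌋)

record Graph (n : ℕ) : Set where
  field
    adj   : Fin n → Fin n → Bool
    sym   : ∀ i j → adj i j ≡ adj j i
    irrefl : ∀ i → adj i i ≡ false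
open Graph public

Σℤ : ∀ k → (Fin k → ℤ) → ℤ
Σℤ zero    f = + 0
Σℤ (suc k) f = f zero + Σℤ k (λ i → f (suc i))

sign : ℕ → ℤ
sign zero    = + 1
sign (suc k) = - sign k

det : ∀ k → (Fin k → Fin k → ℤ) → ℤ
det zero    M = + 1
det (suc k) M =
  Σℤ (suc k) (λ j → sign (toℕ j) * M zero j * det k (λ a b → M (suc a) (punchIn j b)))

b2z : Bool → ℤ
b2z true  = + 1
b2z false = + 0

degree : ∀ {k} → (Fin k → Fin k → Bool) → Fin k → ℤ
degree {k} A i = Σℤ k (λ j → b2z (A i j))

Q : ∀ {k} → (Fin k → Fin k → Bool) → Fin k → Fin k → ℤ
Q A i j = (if ⌊ i ≟F j ⌋ then degree A i else + 0) + b2z (A i j)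

charPoly : ∀ {k} → (Fin k → Fin k → Bool) → ℤ → ℤ
charPoly {k} A x = det k (λ i j → (if ⌊ i ≟F j ⌋ then x else + 0) - Q A i j)

edges : ∀ {n} → Graph n → List (Fin n × Fin n)
edges {n} G = concatMap (λ i → concatMap
  (λ j → if adj G i j ∧ (toℕ i <ᵇ toℕ j) then [ (i , j) ] else [])
  (allFin n)) (allFin n)

edgeCount : ∀ {n} → Graph n → ℕ
edgeCount G = length (edges G)

edge : ∀ {n} (G : Graph n) → Fin (edgeCount G) → Fin n × Fin n
edge G = lookup (edges G)

incident : ∀ {n} → Fin n → Fin n × Fin n → Bool
incident v (i , j) = ⌊ v ≟F i ⌋ ∨ ⌊ v ≟F j ⌋

IsRegular : ∀ {n} → Graph n → ℕ → Set
IsRegular G r = ∀ v → degree (adj G) v ≡ + r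

-- Adjacency of the 10+-transformation G^{10+} on V(G) ⊎ E(G), encoded as
-- Fin (n + m) via splitAt: V(G) induces a complete graph (G^1), E(G) induces
-- an edgeless graph ((G^l)^0), and v ~ e iff v is incident to e (z = +).
adj10+ : ∀ {n} (G : Graph n) → Fin (n ℕ.+ edgeCount G) → Fin (n ℕ.+ edgeCount G) → Bool
adj10+ {n} G x y with splitAt n x | splitAt n y
... | inj₁ u | inj₁ v = not ⌊ u ≟F v ⌋
... | inj₂ e | inj₂ e' = false
... | inj₁ u | inj₂ e = incident u (edge G e)
... | inj₂ e | inj₁ u = incident u (edge G e)

-- Order V(G) before E(G) and let N be the vertex–edge incidence matrix. Then
-- xI − Q(G^{10+}) has blocks ((x − r − n + 2)I − J, −N; −Nᵀ, (x − 2)I), because a vertex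
-- has degree n − 1 + r and an edge degree 2 in G^{10+}. Multiplying the vertex rows by x − 2 and
-- adding N times the edge rows makes the matrix block lower triangular; since NNᵀ = Q(G), the new
-- vertex block is B − (x − 2)J with B = μI − Q(G), μ = (x − r − n + 2)(x − 2). Hence
--   (x − 2)ⁿ f(x, G^{10+}) = (x − 2)ᵐ det(B − (x − 2)J).
-- For r-regular G every column of B sums to μ − 2r, and every column of B − (x − 2)J to
-- μ − 2r − n(x − 2) = x² − (r + 2n)x + 4n − 4. Replacing the first row by the sum of all rows
-- gives (μ − 2r) det(B − (x − 2)J) = (x² − (r + 2n)x + 4n − 4) det B, and det B = f(μ, G).
-- The stated identity is the paper's formula multiplied by (x − 2)ⁿ((x − r − n + 2)(x − 2) − q_n),
-- q_n = 2r, which completes the product over i < n to f(μ, G).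

module Submission where

open import Defs renaming (sym to adj-sym)
open import Data.Bool using (Bool; true; false; if_then_else_; _∧_; not)
open import Data.Empty using (⊥-elim)
open import Data.Fin using (Fin; zero; suc; toℕ; fromℕ<; punchIn; punchOut; _↑ˡ_; _↑ʳ_)
open import Data.Fin.Properties
  using (_≟_; punchInᵢ≢i; punchOut-punchIn; punchOut-cong; toℕ-fromℕ<; toℕ-injective; toℕ<n; suc-injective;
         toℕ-↑ˡ; splitAt-↑ˡ; splitAt-↑ʳ)
open import Data.Integer using (ℤ; +_; _+_; _*_; -_; _-_; _^_)
import Data.Integer.Properties as ℤ
open import Algebra.Properties.Semiring.Sum ℤ.+-*-semiring using (sum; ∑-distrib-+; *-distribˡ-sum; sum-remove)
open import Data.Integer.Tactic.RingSolver using (solve-∀)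
open import Data.List using (List; []; _∷_; [_]; concatMap; length; lookup; tabulate; allFin)
import Data.List as List
open import Data.List.Membership.Propositional.Properties using (∈-lookup)
open import Data.List.Relation.Unary.All as All using (All)
open import Data.List.Relation.Unary.All.Properties using (concat⁺; map⁺; tabulate⁺)
open import Data.Nat using (ℕ; zero; suc; _≤_; _<ᵇ_)
import Data.Nat as ℕ
import Data.Nat.Properties as ℕₚ
open import Data.Product using (_×_; _,_; proj₁; proj₂)
open import Data.Vec.Functional using (_++_)
open import Data.Vec.Functional.Properties using (lookup-++ˡ; lookup-++ʳ)
open import Function using (_∘_; id)
open import Relation.Binary.PropositionalEquality hiding ([_])
open import Relation.Nullary using (yes; no)
open import Relation.Nullary.Decidable using (⌊_⌋)

-- Sums and products over Fin

Σℤ≡sum : ∀ k (f : Fin k → ℤ) → Σℤ k f ≡ sum f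
Σℤ≡sum zero    f = refl
Σℤ≡sum (suc k) f = cong (_+_ (f zero)) (Σℤ≡sum k (λ i → f (suc i)))

Σℤ-cong : ∀ k {f g : Fin k → ℤ} → (∀ i → f i ≡ g i) → Σℤ k f ≡ Σℤ k g
Σℤ-cong zero    f≗g = refl
Σℤ-cong (suc k) f≗g = cong₂ _+_ (f≗g zero) (Σℤ-cong k (λ i → f≗g (suc i)))

Σℤ-zero : ∀ k {f : Fin k → ℤ} → (∀ i → f i ≡ + 0) → Σℤ k f ≡ + 0
Σℤ-zero zero    f≗0 = refl
Σℤ-zero (suc k) f≗0 = cong₂ _+_ (f≗0 zero) (Σℤ-zero k (λ i → f≗0 (suc i)))

Σℤ-+ : ∀ k (f g : Fin k → ℤ) → Σℤ k (λ i → f i + g i) ≡ Σℤ k f + Σℤ k g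
Σℤ-+ k f g rewrite Σℤ≡sum k f | Σℤ≡sum k g | Σℤ≡sum k (λ i → f i + g i) = ∑-distrib-+ f g

Σℤ-*ˡ : ∀ k c (f : Fin k → ℤ) → Σℤ k (λ i → c * f i) ≡ c * Σℤ k f
Σℤ-*ˡ k c f rewrite Σℤ≡sum k f | Σℤ≡sum k (λ i → c * f i) = sym (*-distribˡ-sum c f)

Σℤ-linear : ∀ k α β (f g : Fin k → ℤ) → Σℤ k (λ i → α * f i + β * g i) ≡ α * Σℤ k f + β * Σℤ k g
Σℤ-linear k α β f g = trans (Σℤ-+ k (λ i → α * f i) (λ i → β * g i)) (cong₂ _+_ (Σℤ-*ˡ k α f) (Σℤ-*ˡ k β g))

Σℤ-neg : ∀ k (f : Fin k → ℤ) → Σℤ k (λ i → - f i) ≡ - Σℤ k f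
Σℤ-neg zero    f = refl
Σℤ-neg (suc k) f = trans (cong (_+_ (- f zero)) (Σℤ-neg k (λ i → f (suc i))))
                         (sym (ℤ.neg-distrib-+ (f zero) _))

Σℤ-const : ∀ k c → Σℤ k (λ _ → c) ≡ + k * c
Σℤ-const zero    c = sym (ℤ.*-zeroˡ c)
Σℤ-const (suc k) c = trans (cong (_+_ c) (Σℤ-const k c)) (sym (ℤ.suc-* (+ k) c))

Σℤ-swap : ∀ k l (f : Fin k → Fin l → ℤ) →
          Σℤ k (λ i → Σℤ l (f i)) ≡ Σℤ l (λ j → Σℤ k (λ i → f i j))
Σℤ-swap zero    l f = sym (Σℤ-zero l (λ _ → refl))
Σℤ-swap (suc k) l f = trans (cong (_+_ (Σℤ l (f zero))) (Σℤ-swap k l (λ i → f (suc i))))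
                            (sym (Σℤ-+ l (f zero) (λ j → Σℤ k (λ i → f (suc i) j))))

Σℤ-punchIn : ∀ k (f : Fin (suc k) → ℤ) (j : Fin (suc k)) →
             Σℤ (suc k) f ≡ f j + Σℤ k (λ i → f (punchIn j i))
Σℤ-punchIn k f j rewrite Σℤ≡sum (suc k) f | Σℤ≡sum k (λ i → f (punchIn j i)) = sum-remove {i = j} f

Σℤ-punchIn-zero : ∀ k (f : Fin (suc k) → ℤ) (j : Fin (suc k)) → f j ≡ + 0 →
                  Σℤ k (λ i → f (punchIn j i)) ≡ Σℤ (suc k) f
Σℤ-punchIn-zero k f j fj≡0 =
  sym (trans (Σℤ-punchIn k f j) (trans (cong (_+ Σℤ k (λ i → f (punchIn j i))) fj≡0) (ℤ.+-identityˡ _)))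

Σℤ-↑ : ∀ k l (f : Fin (k ℕ.+ l) → ℤ) →
       Σℤ (k ℕ.+ l) f ≡ Σℤ k (λ i → f (i ↑ˡ l)) + Σℤ l (λ j → f (k ↑ʳ j))
Σℤ-↑ zero    l f = sym (ℤ.+-identityˡ _)
Σℤ-↑ (suc k) l f = trans (cong (_+_ (f zero)) (Σℤ-↑ k l (λ i → f (suc i))))
                         (sym (ℤ.+-assoc (f zero) _ _))

i≡-i⇒i≡0 : ∀ (i : ℤ) → i ≡ - i → i ≡ + 0
i≡-i⇒i≡0 (+ zero) _ = refl

Σℤ-antisymmetric : ∀ k (H : Fin k → Fin k → ℤ) → (∀ i j → H i j ≡ - H j i) →
                   Σℤ k (λ i → Σℤ k (H i)) ≡ + 0
Σℤ-antisymmetric k H antisym = i≡-i⇒i≡0 _ (begin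
  Σℤ k (λ i → Σℤ k (H i))            ≡⟨ Σℤ-swap k k H ⟩
  Σℤ k (λ j → Σℤ k (λ i → H i j))    ≡⟨ Σℤ-cong k (λ j → Σℤ-cong k (λ i → antisym i j)) ⟩
  Σℤ k (λ j → Σℤ k (λ i → - H j i))  ≡⟨ Σℤ-cong k (λ j → Σℤ-neg k (H j)) ⟩
  Σℤ k (λ j → - Σℤ k (H j))          ≡⟨ Σℤ-neg k _ ⟩
  - Σℤ k (λ j → Σℤ k (H j))          ∎)
  where open ≡-Reasoning

Πℤ : ∀ k → (Fin k → ℤ) → ℤ
Πℤ zero    f = + 1
Πℤ (suc k) f = f zero * Πℤ k (f ∘ suc)

Πℤ-cong : ∀ k {f g : Fin k → ℤ} → (∀ i → f i ≡ g i) → Πℤ k f ≡ Πℤ k g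
Πℤ-cong zero    f≗g = refl
Πℤ-cong (suc k) f≗g = cong₂ _*_ (f≗g zero) (Πℤ-cong k (f≗g ∘ suc))

Πℤ-ones : ∀ k {f : Fin k → ℤ} → (∀ i → f i ≡ + 1) → Πℤ k f ≡ + 1
Πℤ-ones zero    f≗1 = refl
Πℤ-ones (suc k) f≗1 = cong₂ _*_ (f≗1 zero) (Πℤ-ones k (f≗1 ∘ suc))

Πℤ-update : ∀ k (f g : Fin k → ℤ) (j : Fin k) → f j ≡ + 1 → (∀ i → i ≢ j → g i ≡ f i) →
            Πℤ k g ≡ g j * Πℤ k f
Πℤ-update (suc k) f g zero    fj≡1 g≗f rewrite fj≡1 =
  cong (g zero *_) (trans (Πℤ-cong k (λ i → g≗f (suc i) (λ ()))) (sym (ℤ.*-identityˡ (Πℤ k (f ∘ suc)))))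
Πℤ-update (suc k) f g (suc j) fj≡1 g≗f = begin
    g zero * Πℤ k (g ∘ suc)
  ≡⟨ cong₂ _*_ (g≗f zero (λ ()))
               (Πℤ-update k (f ∘ suc) (g ∘ suc) j fj≡1 (λ i i≢j → g≗f (suc i) (i≢j ∘ suc-injective))) ⟩
    f zero * (g (suc j) * Πℤ k (f ∘ suc))
  ≡⟨ swap (f zero) (g (suc j)) (Πℤ k (f ∘ suc)) ⟩
    g (suc j) * (f zero * Πℤ k (f ∘ suc))
  ∎
  where
  open ≡-Reasoning
  swap : ∀ a b c → a * (b * c) ≡ b * (a * c)
  swap = solve-∀

<ᵇ-irrefl : ∀ n → (n <ᵇ n) ≡ false
<ᵇ-irrefl zero    = refl
<ᵇ-irrefl (suc n) = <ᵇ-irrefl n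

n<ᵇ1+n : ∀ n → (n <ᵇ suc n) ≡ true
n<ᵇ1+n zero    = refl
n<ᵇ1+n (suc n) = n<ᵇ1+n n

<⇒<ᵇ≡true : ∀ {m n} → m ℕ.< n → (m <ᵇ n) ≡ true
<⇒<ᵇ≡true {zero}  {suc n} _           = refl
<⇒<ᵇ≡true {suc m} {suc n} (ℕ.s≤s m<n) = <⇒<ᵇ≡true m<n

<ᵇ-suc-≢ : ∀ m n → m ≢ n → (m <ᵇ suc n) ≡ (m <ᵇ n)
<ᵇ-suc-≢ zero    zero    m≢n = ⊥-elim (m≢n refl)
<ᵇ-suc-≢ zero    (suc n) _   = refl
<ᵇ-suc-≢ (suc m) zero    _   = refl
<ᵇ-suc-≢ (suc m) (suc n) m≢n = <ᵇ-suc-≢ m n (m≢n ∘ cong suc)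

<ᵇ-trichotomy : ∀ a b → a ≢ b → b2z (a <ᵇ b) + b2z (b <ᵇ a) ≡ + 1
<ᵇ-trichotomy zero    zero    a≢b = ⊥-elim (a≢b refl)
<ᵇ-trichotomy zero    (suc b) _   = refl
<ᵇ-trichotomy (suc a) zero    _   = refl
<ᵇ-trichotomy (suc a) (suc b) a≢b = <ᵇ-trichotomy a b (a≢b ∘ cong suc)

-- Structural recursion makes (suc a ≡ᵇ suc i) reduce to (a ≡ᵇ i), so that a minor of
-- setRow M (suc i) v is definitionally setRow of the corresponding minor of M.
infix 4 _≡ᵇ_

_≡ᵇ_ : ∀ {k} → Fin k → Fin k → Bool
zero  ≡ᵇ zero  = true
zero  ≡ᵇ suc j = false
suc i ≡ᵇ zero  = false
suc i ≡ᵇ suc j = i ≡ᵇ j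

≡ᵇ-refl : ∀ {k} (i : Fin k) → (i ≡ᵇ i) ≡ true
≡ᵇ-refl zero    = refl
≡ᵇ-refl (suc i) = ≡ᵇ-refl i

≡ᵇ⇒≡ : ∀ {k} (i j : Fin k) → (i ≡ᵇ j) ≡ true → i ≡ j
≡ᵇ⇒≡ zero    zero    _  = refl
≡ᵇ⇒≡ (suc i) (suc j) eq = cong suc (≡ᵇ⇒≡ i j eq)

≢⇒≡ᵇ-false : ∀ {k} (i j : Fin k) → i ≢ j → (i ≡ᵇ j) ≡ false
≢⇒≡ᵇ-false i j i≢j with i ≡ᵇ j in eq
... | true  = ⊥-elim (i≢j (≡ᵇ⇒≡ i j eq))
... | false = refl

≡ᵇ-false⇒≢ : ∀ {k} (i j : Fin k) → (i ≡ᵇ j) ≡ false → i ≢ j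
≡ᵇ-false⇒≢ i .i i≢ᵇi refl with () ← trans (sym (≡ᵇ-refl i)) i≢ᵇi

≡ᵇ-sym : ∀ {k} (i j : Fin k) → (i ≡ᵇ j) ≡ (j ≡ᵇ i)
≡ᵇ-sym zero    zero    = refl
≡ᵇ-sym zero    (suc j) = refl
≡ᵇ-sym (suc i) zero    = refl
≡ᵇ-sym (suc i) (suc j) = ≡ᵇ-sym i j

⌊≟⌋≡≡ᵇ : ∀ {k} (i j : Fin k) → ⌊ i ≟ j ⌋ ≡ (i ≡ᵇ j)
⌊≟⌋≡≡ᵇ i j with i ≟ j
... | yes refl = sym (≡ᵇ-refl i)
... | no  i≢j  = sym (≢⇒≡ᵇ-false i j i≢j)

↑ˡ-≡ᵇ-↑ˡ : ∀ {k} l (i j : Fin k) → (i ↑ˡ l ≡ᵇ j ↑ˡ l) ≡ (i ≡ᵇ j)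
↑ˡ-≡ᵇ-↑ˡ l zero    zero    = refl
↑ˡ-≡ᵇ-↑ˡ l zero    (suc j) = refl
↑ˡ-≡ᵇ-↑ˡ l (suc i) zero    = refl
↑ˡ-≡ᵇ-↑ˡ l (suc i) (suc j) = ↑ˡ-≡ᵇ-↑ˡ l i j

↑ˡ-≡ᵇ-↑ʳ : ∀ {k} l (i : Fin k) (e : Fin l) → (i ↑ˡ l ≡ᵇ k ↑ʳ e) ≡ false
↑ˡ-≡ᵇ-↑ʳ l zero    e = refl
↑ˡ-≡ᵇ-↑ʳ l (suc i) e = ↑ˡ-≡ᵇ-↑ʳ l i e

↑ʳ-≡ᵇ-↑ˡ : ∀ {l} k (e : Fin l) (i : Fin k) → (k ↑ʳ e ≡ᵇ i ↑ˡ l) ≡ false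
↑ʳ-≡ᵇ-↑ˡ {l} k e i = trans (≡ᵇ-sym (k ↑ʳ e) (i ↑ˡ l)) (↑ˡ-≡ᵇ-↑ʳ l i e)

↑ʳ-≡ᵇ-↑ʳ : ∀ {l} k (e e′ : Fin l) → (k ↑ʳ e ≡ᵇ k ↑ʳ e′) ≡ (e ≡ᵇ e′)
↑ʳ-≡ᵇ-↑ʳ zero    e e′ = refl
↑ʳ-≡ᵇ-↑ʳ (suc k) e e′ = ↑ʳ-≡ᵇ-↑ʳ k e e′

δ : ∀ {k} → Fin k → Fin k → ℤ
δ i j = b2z (i ≡ᵇ j)

if-δ : ∀ {k} (i j : Fin k) (d : ℤ) → (if ⌊ i ≟ j ⌋ then d else + 0) ≡ δ i j * d
if-δ i j d rewrite ⌊≟⌋≡≡ᵇ i j with i ≡ᵇ j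
... | true  = sym (ℤ.*-identityˡ d)
... | false = sym (ℤ.*-zeroˡ d)

Σℤ-δˡ : ∀ k (u : Fin k) (f : Fin k → ℤ) → Σℤ k (λ i → δ u i * f i) ≡ f u
Σℤ-δˡ (suc k) zero    f = begin
    + 1 * f zero + Σℤ k (λ i → + 0 * f (suc i))
  ≡⟨ cong₂ _+_ (ℤ.*-identityˡ (f zero)) (Σℤ-zero k (λ i → ℤ.*-zeroˡ (f (suc i)))) ⟩
    f zero + + 0
  ≡⟨ ℤ.+-identityʳ (f zero) ⟩
    f zero
  ∎
  where open ≡-Reasoning
Σℤ-δˡ (suc k) (suc u) f = begin
    + 0 * f zero + Σℤ k (λ i → δ u i * f (suc i))
  ≡⟨ cong₂ _+_ (ℤ.*-zeroˡ (f zero)) (Σℤ-δˡ k u (λ i → f (suc i))) ⟩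
    + 0 + f (suc u)
  ≡⟨ ℤ.+-identityˡ (f (suc u)) ⟩
    f (suc u)
  ∎
  where open ≡-Reasoning

Σℤ-δʳ : ∀ k (u : Fin k) (f : Fin k → ℤ) → Σℤ k (λ i → δ i u * f i) ≡ f u
Σℤ-δʳ k u f = trans (Σℤ-cong k (λ i → cong (λ b → b2z b * f i) (≡ᵇ-sym i u))) (Σℤ-δˡ k u f)

Σℤ²-δ : ∀ k (u : Fin k) (F : Fin k → Fin k → ℤ) → Σℤ k (λ i → Σℤ k (λ j → δ u i * F i j)) ≡ Σℤ k (F u)
Σℤ²-δ k u F = trans (Σℤ-swap k k (λ i j → δ u i * F i j)) (Σℤ-cong k (λ j → Σℤ-δˡ k u (λ i → F i j)))

Σℤ²-endpoints : ∀ k (u : Fin k) (F : Fin k → Fin k → ℤ) →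
                Σℤ k (λ i → Σℤ k (λ j → (δ u i + δ u j) * F i j)) ≡ Σℤ k (F u) + Σℤ k (λ i → F i u)
Σℤ²-endpoints k u F = begin
    Σℤ k (λ i → Σℤ k (λ j → (δ u i + δ u j) * F i j))
  ≡⟨ Σℤ-cong k (λ i → trans (Σℤ-cong k (λ j → ℤ.*-distribʳ-+ (F i j) (δ u i) (δ u j))) (Σℤ-+ k _ _)) ⟩
    Σℤ k (λ i → Σℤ k (λ j → δ u i * F i j) + Σℤ k (λ j → δ u j * F i j))
  ≡⟨ Σℤ-+ k _ _ ⟩
    Σℤ k (λ i → Σℤ k (λ j → δ u i * F i j)) + Σℤ k (λ i → Σℤ k (λ j → δ u j * F i j))
  ≡⟨ cong₂ _+_ (Σℤ²-δ k u F) (Σℤ-cong k (λ i → Σℤ-δˡ k u (F i))) ⟩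
    Σℤ k (F u) + Σℤ k (λ i → F i u)
  ∎
  where open ≡-Reasoning

-- Determinants

Matrix : ℕ → Set
Matrix k = Fin k → Fin k → ℤ

minor : ∀ {k} → Matrix (suc k) → Fin (suc k) → Matrix k
minor M j a b = M (suc a) (punchIn j b)

det-cong : ∀ k {M N : Matrix k} → (∀ i j → M i j ≡ N i j) → det k M ≡ det k N
det-cong zero    M≗N = refl
det-cong (suc k) M≗N = Σℤ-cong (suc k) (λ j →
  cong₂ _*_ (cong (sign (toℕ j) *_) (M≗N zero j)) (det-cong k (λ a b → M≗N (suc a) (punchIn j b))))

setRow : ∀ {k} → Matrix k → Fin k → (Fin k → ℤ) → Matrix k
setRow M i v a b = if a ≡ᵇ i then v b else M a b

setRow-≡ : ∀ {k} (M : Matrix k) (i : Fin k) v b → setRow M i v i b ≡ v b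
setRow-≡ M i v b rewrite ≡ᵇ-refl i = refl

setRow-≢ : ∀ {k} (M : Matrix k) {i a : Fin k} v b → a ≢ i → setRow M i v a b ≡ M a b
setRow-≢ M {i} {a} v b a≢i rewrite ≢⇒≡ᵇ-false a i a≢i = refl

setRow-self : ∀ {k} (M : Matrix k) i a b → setRow M i (M i) a b ≡ M a b
setRow-self M i a b with a ≡ᵇ i in a≡i
... | true  = cong (λ c → M c b) (sym (≡ᵇ⇒≡ a i a≡i))
... | false = refl

setRow-comm : ∀ {k} (M : Matrix k) {i j : Fin k} → i ≢ j → ∀ u w a b →
              setRow (setRow M i u) j w a b ≡ setRow (setRow M j w) i u a b
setRow-comm M {i} {j} i≢j u w a b with a ≡ᵇ j in a≡j | a ≡ᵇ i in a≡i
... | true  | true  = ⊥-elim (i≢j (trans (sym (≡ᵇ⇒≡ a i a≡i)) (≡ᵇ⇒≡ a j a≡j)))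
... | true  | false = refl
... | false | true  = refl
... | false | false = refl

det-setRow-linear : ∀ k (M : Matrix k) (i : Fin k) (u v : Fin k → ℤ) α β →
  det k (setRow M i (λ b → α * u b + β * v b)) ≡ α * det k (setRow M i u) + β * det k (setRow M i v)
det-setRow-linear (suc k) M zero u v α β =
  trans (Σℤ-cong (suc k) (λ j → distrib α β (sign (toℕ j)) (u j) (v j) (det k (minor M j))))
        (Σℤ-linear (suc k) α β (λ j → sign (toℕ j) * u j * det k (minor M j))
                                (λ j → sign (toℕ j) * v j * det k (minor M j)))
  where
  distrib : ∀ α β s x y d → s * (α * x + β * y) * d ≡ α * (s * x * d) + β * (s * y * d)
  distrib = solve-∀
det-setRow-linear (suc k) M (suc i) u v α β =
  trans (Σℤ-cong (suc k) (λ j → trans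
          (cong (sign (toℕ j) * M zero j *_)
                (det-setRow-linear k (minor M j) i (u ∘ punchIn j) (v ∘ punchIn j) α β))
          (distrib α β (sign (toℕ j) * M zero j) _ _)))
        (Σℤ-linear (suc k) α β (expansion (setRow M (suc i) u)) (expansion (setRow M (suc i) v)))
  where
  expansion : Matrix (suc k) → Fin (suc k) → ℤ
  expansion N j = sign (toℕ j) * M zero j * det k (minor N j)
  distrib : ∀ α β c x y → c * (α * x + β * y) ≡ α * (c * x) + β * (c * y)
  distrib = solve-∀

det-setRow-+ : ∀ k (M : Matrix k) (i : Fin k) (u v : Fin k → ℤ) →
  det k (setRow M i (λ b → u b + v b)) ≡ det k (setRow M i u) + det k (setRow M i v)
det-setRow-+ k M i u v =
  trans (det-cong k (λ a b → cong (λ x → if a ≡ᵇ i then x else M a b) (unit (u b) (v b))))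
        (trans (det-setRow-linear k M i u v (+ 1) (+ 1))
               (cong₂ _+_ (ℤ.*-identityˡ (det k (setRow M i u))) (ℤ.*-identityˡ (det k (setRow M i v)))))
  where
  unit : ∀ x y → x + y ≡ + 1 * x + + 1 * y
  unit = solve-∀

det-setRow-* : ∀ k (M : Matrix k) (i : Fin k) (c : ℤ) (u : Fin k → ℤ) →
               det k (setRow M i (λ b → c * u b)) ≡ c * det k (setRow M i u)
det-setRow-* k M i c u =
  trans (det-cong k (λ a b → cong (λ x → if a ≡ᵇ i then x else M a b) (sym (ℤ.+-identityʳ (c * u b)))))
        (trans (det-setRow-linear k M i u u c (+ 0)) (ℤ.+-identityʳ _))

det-setRow-Σ : ∀ k (M : Matrix k) (i : Fin k) p (w : Fin p → ℤ) (R : Fin p → Fin k → ℤ) →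
  det k (setRow M i (λ b → Σℤ p (λ q → w q * R q b))) ≡ Σℤ p (λ q → w q * det k (setRow M i (R q)))
det-setRow-Σ k M i zero    w R = det-setRow-* k M i (+ 0) (M i)
det-setRow-Σ k M i (suc p) w R =
  trans (det-setRow-+ k M i (λ b → w zero * R zero b) (λ b → Σℤ p (λ q → w (suc q) * R (suc q) b)))
        (cong₂ _+_ (det-setRow-* k M i (w zero) (R zero)) (det-setRow-Σ k M i p (w ∘ suc) (R ∘ suc)))

punchIn-punchOut-comm : ∀ {k} (c₁ c₂ : Fin (suc (suc k))) (c₁≢c₂ : c₁ ≢ c₂) (c₂≢c₁ : c₂ ≢ c₁) (b : Fin k) →
  punchIn c₁ (punchIn (punchOut c₁≢c₂) b) ≡ punchIn c₂ (punchIn (punchOut c₂≢c₁) b)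
punchIn-punchOut-comm zero    zero    c₁≢c₂ _ b = ⊥-elim (c₁≢c₂ refl)
punchIn-punchOut-comm zero    (suc c) _     _ b = refl
punchIn-punchOut-comm (suc c) zero    _     _ b = refl
punchIn-punchOut-comm (suc c₁) (suc c₂) _   _ zero = refl
punchIn-punchOut-comm (suc c₁) (suc c₂) c₁≢c₂ c₂≢c₁ (suc b) =
  cong suc (punchIn-punchOut-comm c₁ c₂ (c₁≢c₂ ∘ cong suc) (c₂≢c₁ ∘ cong suc) b)

sign-punchOut-antisym : ∀ {k} (c₁ c₂ : Fin (suc k)) (c₁≢c₂ : c₁ ≢ c₂) (c₂≢c₁ : c₂ ≢ c₁) →
  sign (toℕ c₁) * sign (toℕ (punchOut c₁≢c₂)) ≡ - (sign (toℕ c₂) * sign (toℕ (punchOut c₂≢c₁)))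
sign-punchOut-antisym zero zero c₁≢c₂ _ = ⊥-elim (c₁≢c₂ refl)
sign-punchOut-antisym {suc k} zero (suc c) _ _ = flipFirst (sign (toℕ c))
  where
  flipFirst : ∀ s → + 1 * s ≡ - ((- s) * + 1)
  flipFirst = solve-∀
sign-punchOut-antisym {suc k} (suc c) zero _ _ = flipSecond (sign (toℕ c))
  where
  flipSecond : ∀ s → (- s) * + 1 ≡ - (+ 1 * s)
  flipSecond = solve-∀
sign-punchOut-antisym {suc k} (suc c₁) (suc c₂) c₁≢c₂ c₂≢c₁ =
  trans (negate² (sign (toℕ c₁)) _)
        (trans (sign-punchOut-antisym c₁ c₂ (c₁≢c₂ ∘ cong suc) (c₂≢c₁ ∘ cong suc))
               (sym (cong -_ (negate² (sign (toℕ c₂)) _))))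
  where
  negate² : ∀ a b → (- a) * (- b) ≡ a * b
  negate² = solve-∀

-- Expanding along rows 0 and 1 writes det M as a sum of H c₁ c₂ over all pairs of columns,
-- and equality of the two rows makes H antisymmetric.
det-equalRows₀₁ : ∀ k (M : Matrix (suc (suc k))) → (∀ b → M zero b ≡ M (suc zero) b) →
                  det (suc (suc k)) M ≡ + 0
det-equalRows₀₁ k M rows≡ = begin
    det (suc (suc k)) M
  ≡⟨ Σℤ-cong (suc (suc k)) (λ j → sym (Σℤ-*ˡ (suc k) (sign (toℕ j) * M zero j)
                                        (λ l → sign (toℕ l) * M (suc zero) (punchIn j l) * D j l))) ⟩
    Σℤ (suc (suc k)) (λ j → Σℤ (suc k) (λ l →
      sign (toℕ j) * M zero j * (sign (toℕ l) * M (suc zero) (punchIn j l) * D j l)))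
  ≡⟨ Σℤ-cong (suc (suc k)) (λ j → Σℤ-cong (suc k) (expansion-term j)) ⟩
    Σℤ (suc (suc k)) (λ j → Σℤ (suc k) (λ l → H j (punchIn j l)))
  ≡⟨ Σℤ-cong (suc (suc k)) (λ j → Σℤ-punchIn-zero (suc k) (H j) j (H-diagonal j)) ⟩
    Σℤ (suc (suc k)) (λ j → Σℤ (suc (suc k)) (H j))
  ≡⟨ Σℤ-antisymmetric (suc (suc k)) H H-antisymmetric ⟩
    + 0
  ∎
  where
  open ≡-Reasoning
  D : Fin (suc (suc k)) → Fin (suc k) → ℤ
  D j l = det k (minor (minor M j) l)

  H : Fin (suc (suc k)) → Fin (suc (suc k)) → ℤ
  H c₁ c₂ with c₁ ≟ c₂
  ... | yes _    = + 0
  ... | no c₁≢c₂ =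
    sign (toℕ c₁) * sign (toℕ (punchOut c₁≢c₂)) * (M zero c₁ * M zero c₂) * D c₁ (punchOut c₁≢c₂)

  H-diagonal : ∀ j → H j j ≡ + 0
  H-diagonal j with j ≟ j
  ... | yes _  = refl
  ... | no j≢j = ⊥-elim (j≢j refl)

  H-antisymmetric : ∀ c₁ c₂ → H c₁ c₂ ≡ - H c₂ c₁
  H-antisymmetric c₁ c₂ with c₁ ≟ c₂ | c₂ ≟ c₁
  ... | yes _     | yes _     = refl
  ... | yes c₁≡c₂ | no c₂≢c₁  = ⊥-elim (c₂≢c₁ (sym c₁≡c₂))
  ... | no c₁≢c₂  | yes c₂≡c₁ = ⊥-elim (c₁≢c₂ (sym c₂≡c₁))
  ... | no c₁≢c₂  | no c₂≢c₁  =
    trans (cong₂ (λ s d → s * (M zero c₁ * M zero c₂) * d)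
                 (sign-punchOut-antisym c₁ c₂ c₁≢c₂ c₂≢c₁)
                 (det-cong k (λ a b → cong (M (suc (suc a))) (punchIn-punchOut-comm c₁ c₂ c₁≢c₂ c₂≢c₁ b))))
          (negate-swap (sign (toℕ c₂) * sign (toℕ (punchOut c₂≢c₁))) (M zero c₁) (M zero c₂)
                       (D c₂ (punchOut c₂≢c₁)))
    where
    negate-swap : ∀ s x y d → - s * (x * y) * d ≡ - (s * (y * x) * d)
    negate-swap = solve-∀

  expansion-term : ∀ j l → sign (toℕ j) * M zero j * (sign (toℕ l) * M (suc zero) (punchIn j l) * D j l)
                         ≡ H j (punchIn j l)
  expansion-term j l with j ≟ punchIn j l
  ... | yes j≡ = ⊥-elim (punchInᵢ≢i j l (sym j≡))
  ... | no j≢ =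
    trans (cong (λ x → sign (toℕ j) * M zero j * (sign (toℕ l) * x * D j l)) (sym (rows≡ (punchIn j l))))
          (trans (regroup (sign (toℕ j)) (M zero j) (sign (toℕ l)) (M zero (punchIn j l)) (D j l))
                 (cong (λ l′ → sign (toℕ j) * sign (toℕ l′) * (M zero j * M zero (punchIn j l)) * D j l′)
                       (sym punchOut≡l)))
    where
    regroup : ∀ a b c d f → a * b * (c * d * f) ≡ a * c * (b * d) * f
    regroup = solve-∀
    punchOut≡l : punchOut j≢ ≡ l
    punchOut≡l = trans (punchOut-cong j refl) (punchOut-punchIn j)

Alternating : ℕ → Set
Alternating k = ∀ (M : Matrix k) (i j : Fin k) → i ≢ j → (∀ b → M i b ≡ M j b) → det k M ≡ + 0

swapRows : ∀ {k} → Matrix k → Fin k → Fin k → Matrix k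
swapRows M i j = setRow (setRow M j (M i)) i (M j)

-- With A w u the determinant after replacing row j by w and row i by u, A is bilinear and
-- vanishes on the diagonal, so 0 = A (Mᵢ + Mⱼ) (Mᵢ + Mⱼ) = A Mᵢ Mⱼ + A Mⱼ Mᵢ.
det-swapRows : ∀ k → Alternating k → (M : Matrix k) (i j : Fin k) → i ≢ j →
               det k (swapRows M i j) ≡ - det k M
det-swapRows k alternating M i j i≢j =
  ℤ.i-j≡0⇒i≡j _ _ (trans (cong (_+_ (A (M i) (M j))) (ℤ.neg-involutive _))
                         (trans (cong (_+_ (A (M i) (M j))) (sym A-original)) pairs))
  where
  open ≡-Reasoning
  A : (Fin k → ℤ) → (Fin k → ℤ) → ℤ
  A w u = det k (setRow (setRow M j w) i u)

  A-+ʳ : ∀ w u v → A w (λ b → u b + v b) ≡ A w u + A w v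
  A-+ʳ w = det-setRow-+ k (setRow M j w) i

  A-+ˡ : ∀ u v w → A (λ b → u b + v b) w ≡ A u w + A v w
  A-+ˡ u v w = begin
      A (λ b → u b + v b) w
    ≡⟨ det-cong k (setRow-comm M (i≢j ∘ sym) _ w) ⟩
      det k (setRow (setRow M i w) j (λ b → u b + v b))
    ≡⟨ det-setRow-+ k (setRow M i w) j u v ⟩
      det k (setRow (setRow M i w) j u) + det k (setRow (setRow M i w) j v)
    ≡⟨ cong₂ _+_ (det-cong k (setRow-comm M i≢j w u)) (det-cong k (setRow-comm M i≢j w v)) ⟩
      A u w + A v w
    ∎

  A-diagonal : ∀ v → A v v ≡ + 0
  A-diagonal v = alternating _ i j i≢j row-i≡row-j
    where
    row-i≡row-j : ∀ b → setRow (setRow M j v) i v i b ≡ setRow (setRow M j v) i v j b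
    row-i≡row-j b rewrite ≡ᵇ-refl i | ≢⇒≡ᵇ-false j i (i≢j ∘ sym) | ≡ᵇ-refl j = refl

  A-original : A (M j) (M i) ≡ det k M
  A-original = det-cong k (λ a b → trans (cong (λ x → if a ≡ᵇ i then M i b else x) (setRow-self M j a b))
                                         (setRow-self M i a b))

  pairs : A (M i) (M j) + A (M j) (M i) ≡ + 0
  pairs = begin
      A (M i) (M j) + A (M j) (M i)
    ≡⟨ cong₂ _+_ (sym (ℤ.+-identityˡ (A (M i) (M j)))) (sym (ℤ.+-identityʳ (A (M j) (M i)))) ⟩
      (+ 0 + A (M i) (M j)) + (A (M j) (M i) + + 0)
    ≡⟨ cong₂ (λ x y → (x + A (M i) (M j)) + (A (M j) (M i) + y))
             (sym (A-diagonal (M i))) (sym (A-diagonal (M j))) ⟩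
      (A (M i) (M i) + A (M i) (M j)) + (A (M j) (M i) + A (M j) (M j))
    ≡⟨ cong₂ _+_ (sym (A-+ʳ (M i) (M i) (M j))) (sym (A-+ʳ (M j) (M i) (M j))) ⟩
      A (M i) (λ b → M i b + M j b) + A (M j) (λ b → M i b + M j b)
    ≡⟨ sym (A-+ˡ (M i) (M j) _) ⟩
      A (λ b → M i b + M j b) (λ b → M i b + M j b)
    ≡⟨ A-diagonal _ ⟩
      + 0
    ∎

det-swapLowerRows : ∀ k → Alternating k → (M : Matrix (suc k)) (i j : Fin k) → i ≢ j →
                    det (suc k) (swapRows M (suc i) (suc j)) ≡ - det (suc k) M
det-swapLowerRows k alternating M i j i≢j =
  trans (Σℤ-cong (suc k) (λ c → trans (cong (sign (toℕ c) * M zero c *_)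
                                             (det-swapRows k alternating (minor M c) i j i≢j))
                                       (sym (ℤ.neg-distribʳ-* (sign (toℕ c) * M zero c) (det k (minor M c))))))
        (Σℤ-neg (suc k) (λ c → sign (toℕ c) * M zero c * det k (minor M c)))

det-equalRows₀ : ∀ k → Alternating (suc k) → (M : Matrix (suc (suc k))) (j : Fin (suc k)) →
                 (∀ b → M zero b ≡ M (suc j) b) → det (suc (suc k)) M ≡ + 0
det-equalRows₀ k alternating M zero    rows≡ = det-equalRows₀₁ k M rows≡
det-equalRows₀ k alternating M (suc j) rows≡ = begin
    det (suc (suc k)) M
  ≡⟨ sym (ℤ.neg-involutive _) ⟩
    - - det (suc (suc k)) M
  ≡⟨ cong -_ (sym (det-swapLowerRows (suc k) alternating M zero (suc j) (λ ()))) ⟩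
    - det (suc (suc k)) M′
  ≡⟨ cong -_ (det-equalRows₀₁ k M′ rows≡) ⟩
    + 0
  ∎
  where
  open ≡-Reasoning
  M′ : Matrix (suc (suc k))
  M′ = swapRows M (suc zero) (suc (suc j))

alternating-suc : ∀ k → Alternating k → Alternating (suc k)
alternating-suc k       alternating M zero zero i≢j rows≡ = ⊥-elim (i≢j refl)
alternating-suc (suc k) alternating M zero (suc j) _ rows≡ = det-equalRows₀ k alternating M j rows≡
alternating-suc (suc k) alternating M (suc i) zero _ rows≡ = det-equalRows₀ k alternating M i (sym ∘ rows≡)
alternating-suc k alternating M (suc i) (suc j) i≢j rows≡ =
  Σℤ-zero (suc k) (λ c → trans (cong (sign (toℕ c) * M zero c *_)
                                     (alternating (minor M c) i j (i≢j ∘ cong suc) (rows≡ ∘ punchIn c)))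
                               (ℤ.*-zeroʳ (sign (toℕ c) * M zero c)))

det-equalRows : ∀ k → Alternating k
det-equalRows zero    M () j i≢j rows≡
det-equalRows (suc k) = alternating-suc k (det-equalRows k)

det-addRowCombination : ∀ k (M : Matrix k) (i : Fin k) (c : ℤ) (w : Fin k → ℤ) → w i ≡ + 0 →
  det k (setRow M i (λ b → c * M i b + Σℤ k (λ l → w l * M l b))) ≡ c * det k M
det-addRowCombination k M i c w wᵢ≡0 = begin
    det k (setRow M i (λ b → c * M i b + Σℤ k (λ l → w l * M l b)))
  ≡⟨ det-setRow-+ k M i _ _ ⟩
    det k (setRow M i (λ b → c * M i b)) + det k (setRow M i (λ b → Σℤ k (λ l → w l * M l b)))
  ≡⟨ cong₂ _+_ (det-setRow-* k M i c (M i)) (det-setRow-Σ k M i k w M) ⟩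
    c * det k (setRow M i (M i)) + Σℤ k (λ l → w l * det k (setRow M i (M l)))
  ≡⟨ cong₂ _+_ (cong (c *_) (det-cong k (setRow-self M i))) (Σℤ-zero k term≡0) ⟩
    c * det k M + + 0
  ≡⟨ ℤ.+-identityʳ _ ⟩
    c * det k M
  ∎
  where
  open ≡-Reasoning
  term≡0 : ∀ l → w l * det k (setRow M i (M l)) ≡ + 0
  term≡0 l with l ≡ᵇ i in l≡i
  ... | true  rewrite ≡ᵇ⇒≡ l i l≡i | wᵢ≡0 = refl
  ... | false = trans (cong (w l *_) (det-equalRows k (setRow M i (M l)) i l i≢l rows≡)) (ℤ.*-zeroʳ (w l))
    where
    i≢l : i ≢ l
    i≢l = ≡ᵇ-false⇒≢ l i l≡i ∘ sym
    rows≡ : ∀ b → setRow M i (M l) i b ≡ setRow M i (M l) l b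
    rows≡ b rewrite ≡ᵇ-refl i | l≡i = refl

module _ (k : ℕ) (S : Fin k → Bool) (c : ℤ) (w : Matrix k) (M M′ : Matrix k)
         (w-vanishes-on-S : ∀ i l → S l ≡ true → w i l ≡ + 0)
         (M′-on-S : ∀ i → S i ≡ true → ∀ b → M′ i b ≡ c * M i b + Σℤ k (λ l → w i l * M l b))
         (M′-off-S : ∀ i → S i ≡ false → ∀ b → M′ i b ≡ M i b) where

  private
    scale : Fin k → ℤ
    scale i = if S i then c else + 1

    -- The rows below t are processed; the invariant is det (partial t) = Πℤ k (partialScale t) * det M.
    partial : ℕ → Matrix k
    partial t i = if toℕ i <ᵇ t then M′ i else M i

    partialScale : ℕ → Fin k → ℤ
    partialScale t i = if toℕ i <ᵇ t then scale i else + 1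

    partial-off-S : ∀ t l → S l ≡ false → ∀ b → partial t l b ≡ M l b
    partial-off-S t l S-l b with toℕ l <ᵇ t
    ... | true  = M′-off-S l S-l b
    ... | false = refl

    module Step (t : ℕ) (t<k : t ℕ.< k) where
      i₀ : Fin k
      i₀ = fromℕ< t<k

      i₀-new : (toℕ i₀ <ᵇ suc t) ≡ true
      i₀-new = trans (cong (_<ᵇ suc t) (toℕ-fromℕ< t<k)) (n<ᵇ1+n t)

      i₀-old : (toℕ i₀ <ᵇ t) ≡ false
      i₀-old = trans (cong (_<ᵇ t) (toℕ-fromℕ< t<k)) (<ᵇ-irrefl t)

      others : ∀ i → i ≢ i₀ → (toℕ i <ᵇ suc t) ≡ (toℕ i <ᵇ t)
      others i i≢i₀ = <ᵇ-suc-≢ (toℕ i) t (λ i≡t → i≢i₀ (toℕ-injective (trans i≡t (sym (toℕ-fromℕ< t<k)))))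

      row-new : ∀ b → partial (suc t) i₀ b ≡ M′ i₀ b
      row-new b rewrite i₀-new = refl

      row-old : ∀ b → partial t i₀ b ≡ M i₀ b
      row-old b rewrite i₀-old = refl

      row-other : ∀ a → a ≢ i₀ → ∀ b → partial (suc t) a b ≡ partial t a b
      row-other a a≢i₀ b rewrite others a a≢i₀ = refl

      partialScale-step : Πℤ k (partialScale (suc t)) ≡ scale i₀ * Πℤ k (partialScale t)
      partialScale-step =
        trans (Πℤ-update k (partialScale t) (partialScale (suc t)) i₀
                 (cong (λ b → if b then scale i₀ else + 1) i₀-old)
                 (λ i i≢i₀ → cong (λ b → if b then scale i else + 1) (others i i≢i₀)))
              (cong (λ b → (if b then scale i₀ else + 1) * Πℤ k (partialScale t)) i₀-new)

      det-partial-step : det k (partial (suc t)) ≡ scale i₀ * det k (partial t)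
      det-partial-step with S i₀ in S-i₀
      ... | false = trans (det-cong k unchanged) (sym (ℤ.*-identityˡ (det k (partial t))))
        where
        unchanged : ∀ a b → partial (suc t) a b ≡ partial t a b
        unchanged a b with a ≟ i₀
        ... | yes refl = trans (row-new b) (trans (M′-off-S i₀ S-i₀ b) (sym (row-old b)))
        ... | no a≢i₀  = row-other a a≢i₀ b
      ... | true =
        trans (det-cong k agree) (det-addRowCombination k (partial t) i₀ c (w i₀) (w-vanishes-on-S i₀ i₀ S-i₀))
        where
        combination-unchanged : ∀ b → Σℤ k (λ l → w i₀ l * M l b) ≡ Σℤ k (λ l → w i₀ l * partial t l b)
        combination-unchanged b = Σℤ-cong k term
          where
          term : ∀ l → w i₀ l * M l b ≡ w i₀ l * partial t l b
          term l with S l in S-l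
          ... | true  rewrite w-vanishes-on-S i₀ l S-l = refl
          ... | false = cong (w i₀ l *_) (sym (partial-off-S t l S-l b))
        newRow : Fin k → ℤ
        newRow b = c * partial t i₀ b + Σℤ k (λ l → w i₀ l * partial t l b)
        agree : ∀ a b → partial (suc t) a b ≡ setRow (partial t) i₀ newRow a b
        agree a b with a ≟ i₀
        ... | yes refl = begin
            partial (suc t) i₀ b                      ≡⟨ row-new b ⟩
            M′ i₀ b                                   ≡⟨ M′-on-S i₀ S-i₀ b ⟩
            c * M i₀ b + Σℤ k (λ l → w i₀ l * M l b)  ≡⟨ cong₂ (λ x y → c * x + y) (sym (row-old b))
                                                                         (combination-unchanged b) ⟩
            newRow b                                  ≡⟨ sym (setRow-≡ (partial t) i₀ newRow b) ⟩
            setRow (partial t) i₀ newRow i₀ b         ∎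
          where open ≡-Reasoning
        ... | no a≢i₀ = trans (row-other a a≢i₀ b) (sym (setRow-≢ (partial t) newRow b a≢i₀))

    det-partial : ∀ t → t ℕ.≤ k → det k (partial t) ≡ Πℤ k (partialScale t) * det k M
    det-partial zero    _   =
      sym (trans (cong (_* det k M) (Πℤ-ones k (λ _ → refl))) (ℤ.*-identityˡ (det k M)))
    det-partial (suc t) t<k = begin
      det k (partial (suc t))                       ≡⟨ det-partial-step ⟩
      scale i₀ * det k (partial t)                  ≡⟨ cong (scale i₀ *_) (det-partial t (ℕₚ.<⇒≤ t<k)) ⟩
      scale i₀ * (Πℤ k (partialScale t) * det k M)  ≡⟨ sym (ℤ.*-assoc (scale i₀) _ (det k M)) ⟩
      scale i₀ * Πℤ k (partialScale t) * det k M    ≡⟨ cong (_* det k M) (sym partialScale-step) ⟩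
      Πℤ k (partialScale (suc t)) * det k M         ∎
      where
      open Step t t<k
      open ≡-Reasoning

    all-processed : ∀ (i : Fin k) → (toℕ i <ᵇ k) ≡ true
    all-processed i = <⇒<ᵇ≡true (toℕ<n i)

  det-rowOperations : det k M′ ≡ Πℤ k (λ i → if S i then c else + 1) * det k M
  det-rowOperations = begin
      det k M′
    ≡⟨ det-cong k (λ a b → cong (λ x → (if x then M′ a else M a) b) (sym (all-processed a))) ⟩
      det k (partial k)
    ≡⟨ det-partial k ℕₚ.≤-refl ⟩
      Πℤ k (partialScale k) * det k M
    ≡⟨ cong (_* det k M) (Πℤ-cong k (λ i → cong (λ x → if x then scale i else + 1) (all-processed i))) ⟩
      Πℤ k scale * det k M
    ∎
    where open ≡-Reasoning

scalarMatrix : ∀ {k} → ℤ → Matrix k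
scalarMatrix d i j = if i ≡ᵇ j then d else + 0

det-scalarMatrix : ∀ k d → det k (scalarMatrix d) ≡ d ^ k
det-scalarMatrix zero    d = refl
det-scalarMatrix (suc k) d = begin
    + 1 * d * det k (scalarMatrix d)
      + Σℤ k (λ j → sign (toℕ (suc j)) * + 0 * det k (minor (scalarMatrix d) (suc j)))
  ≡⟨ cong₂ _+_ (cong (+ 1 * d *_) (det-scalarMatrix k d))
               (Σℤ-zero k (λ j → zero-middle (sign (toℕ (suc j))) (det k (minor (scalarMatrix d) (suc j))))) ⟩
    + 1 * d * d ^ k + + 0
  ≡⟨ cleanup d (d ^ k) ⟩
    d * d ^ k
  ∎
  where
  open ≡-Reasoning
  zero-middle : ∀ s x → s * + 0 * x ≡ + 0
  zero-middle = solve-∀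
  cleanup : ∀ d x → + 1 * d * x + + 0 ≡ d * x
  cleanup = solve-∀

scalarMatrix-δ : ∀ {k} (d : ℤ) (i j : Fin k) → scalarMatrix d i j ≡ δ i j * d
scalarMatrix-δ d i j with i ≡ᵇ j
... | true  = sym (ℤ.*-identityˡ d)
... | false = sym (ℤ.*-zeroˡ d)

punchIn-↑ˡ : ∀ {k} l (i : Fin (suc k)) (j : Fin k) → punchIn (i ↑ˡ l) (j ↑ˡ l) ≡ punchIn i j ↑ˡ l
punchIn-↑ˡ l zero    j       = refl
punchIn-↑ˡ l (suc i) zero    = refl
punchIn-↑ˡ l (suc i) (suc j) = cong suc (punchIn-↑ˡ l i j)

punchIn-↑ʳ : ∀ {k} l (i : Fin (suc k)) (e : Fin l) → punchIn (i ↑ˡ l) (k ↑ʳ e) ≡ suc k ↑ʳ e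
punchIn-↑ʳ l zero    e = refl
punchIn-↑ʳ {suc k} l (suc i) e = cong suc (punchIn-↑ʳ l i e)

det-blockLowerTriangular : ∀ k l (A : Matrix k) (d : ℤ) (M : Matrix (k ℕ.+ l)) →
  (∀ u v → M (u ↑ˡ l) (v ↑ˡ l) ≡ A u v) →
  (∀ u e → M (u ↑ˡ l) (k ↑ʳ e) ≡ + 0) →
  (∀ e e′ → M (k ↑ʳ e) (k ↑ʳ e′) ≡ scalarMatrix d e e′) →
  det (k ℕ.+ l) M ≡ det k A * d ^ l
det-blockLowerTriangular zero l A d M _ _ lower-right =
  trans (det-cong l lower-right) (trans (det-scalarMatrix l d) (sym (ℤ.*-identityˡ (d ^ l))))
det-blockLowerTriangular (suc k) l A d M upper-left upper-right lower-right = begin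
    det (suc k ℕ.+ l) M
  ≡⟨ Σℤ-↑ (suc k) l term ⟩
    Σℤ (suc k) (λ u → term (u ↑ˡ l)) + Σℤ l (λ e → term (suc k ↑ʳ e))
  ≡⟨ cong₂ _+_ (Σℤ-cong (suc k) left-term) (Σℤ-zero l right-term) ⟩
    Σℤ (suc k) (λ u → d ^ l * (sign (toℕ u) * A zero u * det k (minor A u))) + + 0
  ≡⟨ ℤ.+-identityʳ _ ⟩
    Σℤ (suc k) (λ u → d ^ l * (sign (toℕ u) * A zero u * det k (minor A u)))
  ≡⟨ Σℤ-*ˡ (suc k) (d ^ l) (λ u → sign (toℕ u) * A zero u * det k (minor A u)) ⟩
    d ^ l * det (suc k) A
  ≡⟨ ℤ.*-comm (d ^ l) (det (suc k) A) ⟩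
    det (suc k) A * d ^ l
  ∎
  where
  open ≡-Reasoning
  term : Fin (suc k ℕ.+ l) → ℤ
  term j = sign (toℕ j) * M zero j * det (k ℕ.+ l) (minor M j)

  left-term : ∀ u → term (u ↑ˡ l) ≡ d ^ l * (sign (toℕ u) * A zero u * det k (minor A u))
  left-term u = begin
      sign (toℕ (u ↑ˡ l)) * M zero (u ↑ˡ l) * det (k ℕ.+ l) (minor M (u ↑ˡ l))
    ≡⟨ cong₂ (λ j x → sign j * x * det (k ℕ.+ l) (minor M (u ↑ˡ l))) (toℕ-↑ˡ u l) (upper-left zero u) ⟩
      sign (toℕ u) * A zero u * det (k ℕ.+ l) (minor M (u ↑ˡ l))
    ≡⟨ cong (sign (toℕ u) * A zero u *_)
            (det-blockLowerTriangular k l (minor A u) d (minor M (u ↑ˡ l))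
              (λ a v → trans (cong (M (suc (a ↑ˡ l))) (punchIn-↑ˡ l u v)) (upper-left (suc a) (punchIn u v)))
              (λ a e → trans (cong (M (suc (a ↑ˡ l))) (punchIn-↑ʳ l u e)) (upper-right (suc a) e))
              (λ e e′ → trans (cong (M (suc k ↑ʳ e)) (punchIn-↑ʳ l u e′)) (lower-right e e′))) ⟩
      sign (toℕ u) * A zero u * (det k (minor A u) * d ^ l)
    ≡⟨ rotate (sign (toℕ u)) (A zero u) (det k (minor A u)) (d ^ l) ⟩
      d ^ l * (sign (toℕ u) * A zero u * det k (minor A u))
    ∎
    where
    rotate : ∀ a b c e → a * b * (c * e) ≡ e * (a * b * c)
    rotate = solve-∀

  right-term : ∀ e → term (suc k ↑ʳ e) ≡ + 0
  right-term e =
    trans (cong (λ x → sign (toℕ (suc k ↑ʳ e)) * x * det (k ℕ.+ l) (minor M (suc k ↑ʳ e))) (upper-right zero e))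
          (zero-middle (sign (toℕ (suc k ↑ʳ e))) _)
    where
    zero-middle : ∀ s x → s * + 0 * x ≡ + 0
    zero-middle = solve-∀

data Block (k l : ℕ) : Fin (k ℕ.+ l) → Set where
  top    : ∀ u → Block k l (u ↑ˡ l)
  bottom : ∀ e → Block k l (k ↑ʳ e)

block : ∀ k l (i : Fin (k ℕ.+ l)) → Block k l i
block zero    l i       = bottom i
block (suc k) l zero    = top zero
block (suc k) l (suc i) with block k l i
... | top u    = top (suc u)
... | bottom e = bottom e

↑ˡ-<ᵇ : ∀ {k} l (u : Fin k) → (toℕ (u ↑ˡ l) <ᵇ k) ≡ true
↑ˡ-<ᵇ l u rewrite toℕ-↑ˡ u l = <⇒<ᵇ≡true (toℕ<n u)

↑ʳ-<ᵇ : ∀ {l} k (e : Fin l) → (toℕ (k ↑ʳ e) <ᵇ k) ≡ false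
↑ʳ-<ᵇ zero    e = refl
↑ʳ-<ᵇ (suc k) e = ↑ʳ-<ᵇ k e

Πℤ-prefix : ∀ k l (c : ℤ) → Πℤ (k ℕ.+ l) (λ i → if toℕ i <ᵇ k then c else + 1) ≡ c ^ k
Πℤ-prefix zero    l c = Πℤ-ones l (λ _ → refl)
Πℤ-prefix (suc k) l c = cong (c *_) (Πℤ-prefix k l c)

det-columnSums : ∀ k (M : Matrix (suc k)) σ → (∀ b → Σℤ (suc k) (λ i → M i b) ≡ σ) →
                 det (suc k) M ≡ σ * det (suc k) (setRow M zero (λ _ → + 1))
det-columnSums k M σ columnSum = begin
    det (suc k) M
  ≡⟨ sym (ℤ.*-identityˡ (det (suc k) M)) ⟩
    + 1 * det (suc k) M
  ≡⟨ sym (det-addRowCombination (suc k) M zero (+ 1) lowerRows refl) ⟩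
    det (suc k) (setRow M zero (λ b → + 1 * M zero b + Σℤ (suc k) (λ l → lowerRows l * M l b)))
  ≡⟨ det-cong (suc k) (λ a b → cong (λ x → if a ≡ᵇ zero then x else M a b) (firstRow≡σ b)) ⟩
    det (suc k) (setRow M zero (λ _ → σ * + 1))
  ≡⟨ det-setRow-* (suc k) M zero σ (λ _ → + 1) ⟩
    σ * det (suc k) (setRow M zero (λ _ → + 1))
  ∎
  where
  open ≡-Reasoning
  lowerRows : Fin (suc k) → ℤ
  lowerRows zero    = + 0
  lowerRows (suc _) = + 1
  firstRow≡σ : ∀ b → + 1 * M zero b + Σℤ (suc k) (λ l → lowerRows l * M l b) ≡ σ * + 1
  firstRow≡σ b = begin
      + 1 * M zero b + (+ 0 * M zero b + Σℤ k (λ l → + 1 * M (suc l) b))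
    ≡⟨ cong (λ s → + 1 * M zero b + (+ 0 * M zero b + s)) (Σℤ-cong k (λ l → ℤ.*-identityˡ (M (suc l) b))) ⟩
      + 1 * M zero b + (+ 0 * M zero b + Σℤ k (λ l → M (suc l) b))
    ≡⟨ cleanup (M zero b) _ ⟩
      Σℤ (suc k) (λ i → M i b)
    ≡⟨ columnSum b ⟩
      σ
    ≡⟨ sym (ℤ.*-identityʳ σ) ⟩
      σ * + 1
    ∎
    where
    cleanup : ∀ x s → + 1 * x + (+ 0 * x + s) ≡ x + s
    cleanup = solve-∀

-- Replacing the first row by the sum of all rows leaves σ times a row of ones, and subtracting
-- γ times that row from the others undoes the shift by γ.
det-subtractConstant : ∀ k (B : Matrix (suc k)) (γ σ₁ σ₂ : ℤ) →
  (∀ b → Σℤ (suc k) (λ i → B i b) ≡ σ₁) → (∀ b → Σℤ (suc k) (λ i → B i b - γ) ≡ σ₂) →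
  σ₁ * det (suc k) (λ i j → B i j - γ) ≡ σ₂ * det (suc k) B
det-subtractConstant k B γ σ₁ σ₂ columnSum₁ columnSum₂ = begin
    σ₁ * det (suc k) (λ i j → B i j - γ)
  ≡⟨ cong (σ₁ *_) (det-columnSums k (λ i j → B i j - γ) σ₂ columnSum₂) ⟩
    σ₁ * (σ₂ * det (suc k) (setRow (λ i j → B i j - γ) zero ones))
  ≡⟨ cong (λ x → σ₁ * (σ₂ * x)) ones-absorb-shift ⟩
    σ₁ * (σ₂ * det (suc k) (setRow B zero ones))
  ≡⟨ swap σ₁ σ₂ _ ⟩
    σ₂ * (σ₁ * det (suc k) (setRow B zero ones))
  ≡⟨ cong (σ₂ *_) (sym (det-columnSums k B σ₁ columnSum₁)) ⟩
    σ₂ * det (suc k) B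
  ∎
  where
  open ≡-Reasoning
  swap : ∀ a b c → a * (b * c) ≡ b * (a * c)
  swap = solve-∀
  ones : Fin (suc k) → ℤ
  ones _ = + 1
  isLower : Fin (suc k) → Bool
  isLower zero    = false
  isLower (suc _) = true
  shift : Matrix (suc k)
  shift _ zero    = - γ
  shift _ (suc _) = + 0
  ones-absorb-shift : det (suc k) (setRow (λ i j → B i j - γ) zero ones) ≡ det (suc k) (setRow B zero ones)
  ones-absorb-shift =
    trans (det-rowOperations (suc k) isLower (+ 1) shift (setRow B zero ones)
                             (setRow (λ i j → B i j - γ) zero ones) vanishes on-lower off-lower)
          (trans (cong (_* det (suc k) (setRow B zero ones)) (Πℤ-ones (suc k) one-either-way))
                 (ℤ.*-identityˡ _))
    where
    vanishes : ∀ i l → isLower l ≡ true → shift i l ≡ + 0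
    vanishes i (suc l) _ = refl
    on-lower : ∀ i → isLower i ≡ true → ∀ b →
               setRow (λ i j → B i j - γ) zero ones i b
               ≡ + 1 * setRow B zero ones i b + Σℤ (suc k) (λ l → shift i l * setRow B zero ones l b)
    on-lower (suc i) _ b =
      trans (expand (B (suc i) b) γ)
            (cong (λ s → + 1 * B (suc i) b + (- γ * + 1 + s)) (sym (Σℤ-zero k (λ l → ℤ.*-zeroˡ (B (suc l) b)))))
      where
      expand : ∀ x g → x - g ≡ + 1 * x + (- g * + 1 + + 0)
      expand = solve-∀
    off-lower : ∀ i → isLower i ≡ false → ∀ b →
                setRow (λ i j → B i j - γ) zero ones i b ≡ setRow B zero ones i b
    off-lower zero _ b = refl
    one-either-way : ∀ i → (if isLower i then + 1 else + 1) ≡ + 1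
    one-either-way zero    = refl
    one-either-way (suc i) = refl

-- The incidence matrix

Σlist : ∀ {A : Set} → (A → ℤ) → List A → ℤ
Σlist h xs = Σℤ (length xs) (h ∘ lookup xs)

Σlist-++ : ∀ {A : Set} (h : A → ℤ) (xs ys : List A) → Σlist h (xs List.++ ys) ≡ Σlist h xs + Σlist h ys
Σlist-++ h []       ys = sym (ℤ.+-identityˡ _)
Σlist-++ h (x ∷ xs) ys = trans (cong (_+_ (h x)) (Σlist-++ h xs ys)) (sym (ℤ.+-assoc (h x) _ _))

Σlist-concatMap : ∀ {A B : Set} (h : B → ℤ) n (f : Fin n → A) (F : A → List B) →
                  Σlist h (concatMap F (tabulate f)) ≡ Σℤ n (λ i → Σlist h (F (f i)))
Σlist-concatMap h zero    f F = refl
Σlist-concatMap h (suc n) f F =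
  trans (Σlist-++ h (F (f zero)) _) (cong (_+_ (Σlist h (F (f zero)))) (Σlist-concatMap h n (f ∘ suc) F))

Σlist-if : ∀ {A : Set} (h : A → ℤ) (b : Bool) (x : A) → Σlist h (if b then [ x ] else []) ≡ b2z b * h x
Σlist-if h true  x = trans (ℤ.+-identityʳ (h x)) (sym (ℤ.*-identityˡ (h x)))
Σlist-if h false x = sym (ℤ.*-zeroˡ (h x))

incident-δ : ∀ {n} (u i j : Fin n) → i ≢ j → b2z (incident u (i , j)) ≡ δ u i + δ u j
incident-δ u i j i≢j rewrite ⌊≟⌋≡≡ᵇ u i | ⌊≟⌋≡≡ᵇ u j with u ≡ᵇ i in u≡i | u ≡ᵇ j in u≡j
... | true  | true  = ⊥-elim (i≢j (trans (sym (≡ᵇ⇒≡ u i u≡i)) (≡ᵇ⇒≡ u j u≡j)))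
... | true  | false = refl
... | false | true  = refl
... | false | false = refl

module _ {n : ℕ} (G : Graph n) where

  -- Defs.edges lists each edge once, as (i , j) with i < j.
  forwardAdj : Fin n → Fin n → Bool
  forwardAdj i j = adj G i j ∧ (toℕ i <ᵇ toℕ j)

  incidence : Fin n → Fin (edgeCount G) → ℤ
  incidence u e = b2z (incident u (edge G e))

  adj⇒≢ : ∀ i j → adj G i j ≡ true → i ≢ j
  adj⇒≢ i .i i~i refl with () ← trans (sym i~i) (irrefl G i)

  forwardAdj⇒≢ : ∀ i j → forwardAdj i j ≡ true → i ≢ j
  forwardAdj⇒≢ i j i→j with adj G i j in i~j | i→j
  ... | true  | _  = adj⇒≢ i j i~j
  ... | false | ()

  edge-forward : ∀ e → forwardAdj (proj₁ (edge G e)) (proj₂ (edge G e)) ≡ true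
  edge-forward e = All.lookup listed (∈-lookup e)
    where
    Forward : Fin n × Fin n → Set
    Forward (i , j) = forwardAdj i j ≡ true
    candidate : Fin n → Fin n → List (Fin n × Fin n)
    candidate i j = if forwardAdj i j then [ (i , j) ] else []
    candidate-forward : ∀ i j → All Forward (candidate i j)
    candidate-forward i j with forwardAdj i j in i→j
    ... | true  = i→j All.∷ All.[]
    ... | false = All.[]
    listed : All Forward (edges G)
    listed = concat⁺ (map⁺ {f = λ i → concatMap (candidate i) (allFin n)} (tabulate⁺ {f = id} (λ i →
               concat⁺ (map⁺ {f = candidate i} (tabulate⁺ {f = id} (candidate-forward i))))))

  forward : Fin n → Fin n → ℤ
  forward i j = b2z (forwardAdj i j)

  Σ-edges : ∀ (h : Fin n × Fin n → ℤ) →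
            Σℤ (edgeCount G) (h ∘ edge G) ≡ Σℤ n (λ i → Σℤ n (λ j → forward i j * h (i , j)))
  Σ-edges h = trans (Σlist-concatMap h n id _) (Σℤ-cong n (λ i →
                trans (Σlist-concatMap h n id _) (Σℤ-cong n (λ j → Σlist-if h (forwardAdj i j) (i , j)))))

  forward-cong : ∀ i j {x y : ℤ} → (i ≢ j → x ≡ y) → forward i j * x ≡ forward i j * y
  forward-cong i j x≡y with adj G i j in i~j
  ... | true  = cong (b2z (toℕ i <ᵇ toℕ j) *_) (x≡y (adj⇒≢ i j i~j))
  ... | false = refl

  forward-+ : ∀ i j → forward i j + forward j i ≡ b2z (adj G i j)
  forward-+ i j rewrite adj-sym G j i with adj G i j in i~j
  ... | false = refl
  ... | true  = <ᵇ-trichotomy (toℕ i) (toℕ j) (adj⇒≢ i j i~j ∘ toℕ-injective)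

  degree-forward : ∀ u → Σℤ n (forward u) + Σℤ n (λ i → forward i u) ≡ degree (adj G) u
  degree-forward u = trans (sym (Σℤ-+ n (forward u) (λ j → forward j u))) (Σℤ-cong n (forward-+ u))

  incidence-rowSum : ∀ u → Σℤ (edgeCount G) (incidence u) ≡ degree (adj G) u
  incidence-rowSum u = begin
      Σℤ (edgeCount G) (incidence u)
    ≡⟨ Σ-edges (λ p → b2z (incident u p)) ⟩
      Σℤ n (λ i → Σℤ n (λ j → forward i j * b2z (incident u (i , j))))
    ≡⟨ Σℤ-cong n (λ i → Σℤ-cong n (λ j →
         trans (forward-cong i j (incident-δ u i j)) (ℤ.*-comm (forward i j) _))) ⟩
      Σℤ n (λ i → Σℤ n (λ j → (δ u i + δ u j) * forward i j))
    ≡⟨ Σℤ²-endpoints n u forward ⟩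
      Σℤ n (forward u) + Σℤ n (λ i → forward i u)
    ≡⟨ degree-forward u ⟩
      degree (adj G) u
    ∎
    where open ≡-Reasoning

  incidence-columnSum : ∀ e → Σℤ n (λ u → incidence u e) ≡ + 2
  incidence-columnSum e with edge G e | edge-forward e
  ... | (i , j) | i→j = begin
      Σℤ n (λ u → b2z (incident u (i , j)))
    ≡⟨ Σℤ-cong n (λ u → trans (incident-δ u i j i≢j)
                              (sym (cong₂ _+_ (ℤ.*-identityʳ (δ u i)) (ℤ.*-identityʳ (δ u j))))) ⟩
      Σℤ n (λ u → δ u i * + 1 + δ u j * + 1)
    ≡⟨ Σℤ-+ n _ _ ⟩
      Σℤ n (λ u → δ u i * + 1) + Σℤ n (λ u → δ u j * + 1)
    ≡⟨ cong₂ _+_ (Σℤ-δʳ n i (λ _ → + 1)) (Σℤ-δʳ n j (λ _ → + 1)) ⟩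
      + 2
    ∎
    where
    open ≡-Reasoning
    i≢j : i ≢ j
    i≢j = forwardAdj⇒≢ i j i→j

  incidence-gram : ∀ u v → Σℤ (edgeCount G) (λ e → incidence u e * incidence v e) ≡ Q (adj G) u v
  incidence-gram u v = begin
      Σℤ (edgeCount G) (λ e → incidence u e * incidence v e)
    ≡⟨ Σ-edges (λ p → b2z (incident u p) * b2z (incident v p)) ⟩
      Σℤ n (λ i → Σℤ n (λ j → forward i j * (b2z (incident u (i , j)) * b2z (incident v (i , j)))))
    ≡⟨ Σℤ-cong n (λ i → Σℤ-cong n (λ j →
         trans (forward-cong i j (λ i≢j → cong₂ _*_ (incident-δ u i j i≢j) (incident-δ v i j i≢j)))
               (regroup (forward i j) (δ u i + δ u j) _))) ⟩
      Σℤ n (λ i → Σℤ n (λ j → (δ u i + δ u j) * X i j))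
    ≡⟨ Σℤ²-endpoints n u X ⟩
      Σℤ n (X u) + Σℤ n (λ i → X i u)
    ≡⟨ cong₂ _+_ (Σℤ-cong n (λ j → ℤ.*-distribʳ-+ (forward u j) (δ v u) (δ v j)))
                 (Σℤ-cong n (λ i → ℤ.*-distribʳ-+ (forward i u) (δ v i) (δ v u))) ⟩
      Σℤ n (λ j → δ v u * forward u j + δ v j * forward u j)
        + Σℤ n (λ i → δ v i * forward i u + δ v u * forward i u)
    ≡⟨ cong₂ _+_
         (trans (Σℤ-+ n _ _) (cong₂ _+_ (Σℤ-*ˡ n (δ v u) (forward u)) (Σℤ-δˡ n v (forward u))))
         (trans (Σℤ-+ n _ _) (cong₂ _+_ (Σℤ-δˡ n v (λ i → forward i u)) (Σℤ-*ˡ n (δ v u) (λ i → forward i u)))) ⟩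
      (δ v u * Σℤ n (forward u) + forward u v) + (forward v u + δ v u * Σℤ n (λ i → forward i u))
    ≡⟨ collect (δ v u) (Σℤ n (forward u)) (Σℤ n (λ i → forward i u)) (forward u v) (forward v u) ⟩
      δ v u * (Σℤ n (forward u) + Σℤ n (λ i → forward i u)) + (forward u v + forward v u)
    ≡⟨ cong₂ _+_ (cong (δ v u *_) (degree-forward u)) (forward-+ u v) ⟩
      δ v u * degree (adj G) u + b2z (adj G u v)
    ≡⟨ cong (_+ b2z (adj G u v))
            (trans (cong (λ b → b2z b * degree (adj G) u) (≡ᵇ-sym v u)) (sym (if-δ u v (degree (adj G) u)))) ⟩
      Q (adj G) u v
    ∎
    where
    open ≡-Reasoning
    X : Fin n → Fin n → ℤ
    X i j = (δ v i + δ v j) * forward i j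
    regroup : ∀ f a b → f * (a * b) ≡ a * (b * f)
    regroup = solve-∀
    collect : ∀ d x y a b → d * x + a + (b + d * y) ≡ d * (x + y) + (a + b)
    collect = solve-∀

-- The signless Laplacian of G^{10+}

charMatrix : ∀ {k} → (Fin k → Fin k → Bool) → ℤ → Matrix k
charMatrix A y i j = (if ⌊ i ≟ j ⌋ then y else + 0) - Q A i j

charMatrix-columnSum : ∀ {n} (G : Graph n) r → IsRegular G r → ∀ y b →
                       Σℤ n (λ i → charMatrix (adj G) y i b) ≡ y - + r - + r
charMatrix-columnSum {n} G r regular y b = begin
    Σℤ n (λ i → charMatrix (adj G) y i b)
  ≡⟨ Σℤ-cong n entry ⟩
    Σℤ n (λ i → diagonal i + (- degreeTerm i + - b2z (adj G b i)))
  ≡⟨ trans (Σℤ-+ n diagonal _)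
           (cong (_+_ (Σℤ n diagonal)) (Σℤ-+ n (λ i → - degreeTerm i) (λ i → - b2z (adj G b i)))) ⟩
    Σℤ n diagonal + (Σℤ n (λ i → - degreeTerm i) + Σℤ n (λ i → - b2z (adj G b i)))
  ≡⟨ cong₂ (λ s t → Σℤ n diagonal + (s + t)) (Σℤ-neg n degreeTerm) (Σℤ-neg n (λ i → b2z (adj G b i))) ⟩
    Σℤ n diagonal + (- Σℤ n degreeTerm + - degree (adj G) b)
  ≡⟨ cong₂ (λ s t → s + (- t + - degree (adj G) b)) (Σℤ-δʳ n b (λ _ → y)) (Σℤ-δʳ n b (degree (adj G))) ⟩
    y + (- degree (adj G) b + - degree (adj G) b)
  ≡⟨ cong (λ d → y + (- d + - d)) (regular b) ⟩
    y + (- + r + - + r)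
  ≡⟨ sym (ℤ.+-assoc y (- + r) (- + r)) ⟩
    y - + r - + r
  ∎
  where
  open ≡-Reasoning
  diagonal degreeTerm : Fin n → ℤ
  diagonal i = δ i b * y
  degreeTerm i = δ i b * degree (adj G) i
  entry : ∀ i → charMatrix (adj G) y i b ≡ diagonal i + (- degreeTerm i + - b2z (adj G b i))
  entry i rewrite if-δ i b y | if-δ i b (degree (adj G) i) | adj-sym G i b =
    cong (_+_ (diagonal i)) (ℤ.neg-distrib-+ (degreeTerm i) (b2z (adj G b i)))

b2z-not : ∀ b → b2z (not b) ≡ + 1 - b2z b
b2z-not true  = refl
b2z-not false = refl

Σℤ-offDiagonal : ∀ k (u : Fin k) → Σℤ k (λ v → b2z (not ⌊ u ≟ v ⌋)) ≡ + k - + 1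
Σℤ-offDiagonal k u = begin
    Σℤ k (λ v → b2z (not ⌊ u ≟ v ⌋))
  ≡⟨ Σℤ-cong k (λ v → trans (b2z-not ⌊ u ≟ v ⌋) (cong (λ b → + 1 - b2z b) (⌊≟⌋≡≡ᵇ u v))) ⟩
    Σℤ k (λ v → + 1 - δ u v)
  ≡⟨ Σℤ-+ k (λ _ → + 1) (λ v → - δ u v) ⟩
    Σℤ k (λ _ → + 1) + Σℤ k (λ v → - δ u v)
  ≡⟨ cong₂ _+_ (trans (Σℤ-const k (+ 1)) (ℤ.*-identityʳ (+ k))) (Σℤ-neg k (δ u)) ⟩
    + k - Σℤ k (δ u)
  ≡⟨ cong (λ s → + k - s) (trans (Σℤ-cong k (λ v → sym (ℤ.*-identityʳ (δ u v)))) (Σℤ-δˡ k u (λ _ → + 1))) ⟩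
    + k - + 1
  ∎
  where open ≡-Reasoning

module _ {n : ℕ} (G : Graph n) where
  private
    m = edgeCount G

  adj10+-vv : ∀ u v → adj10+ G (u ↑ˡ m) (v ↑ˡ m) ≡ not ⌊ u ≟ v ⌋
  adj10+-vv u v rewrite splitAt-↑ˡ n u m | splitAt-↑ˡ n v m = refl

  adj10+-ve : ∀ u e → adj10+ G (u ↑ˡ m) (n ↑ʳ e) ≡ incident u (edge G e)
  adj10+-ve u e rewrite splitAt-↑ˡ n u m | splitAt-↑ʳ n m e = refl

  adj10+-ev : ∀ e v → adj10+ G (n ↑ʳ e) (v ↑ˡ m) ≡ incident v (edge G e)
  adj10+-ev e v rewrite splitAt-↑ʳ n m e | splitAt-↑ˡ n v m = refl

  adj10+-ee : ∀ e e′ → adj10+ G (n ↑ʳ e) (n ↑ʳ e′) ≡ false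
  adj10+-ee e e′ rewrite splitAt-↑ʳ n m e | splitAt-↑ʳ n m e′ = refl

  degree10+-vertex : ∀ r → IsRegular G r → ∀ u → degree (adj10+ G) (u ↑ˡ m) ≡ + n - + 1 + + r
  degree10+-vertex r regular u = begin
      degree (adj10+ G) (u ↑ˡ m)
    ≡⟨ Σℤ-↑ n m (λ j → b2z (adj10+ G (u ↑ˡ m) j)) ⟩
      Σℤ n (λ v → b2z (adj10+ G (u ↑ˡ m) (v ↑ˡ m))) + Σℤ m (λ e → b2z (adj10+ G (u ↑ˡ m) (n ↑ʳ e)))
    ≡⟨ cong₂ _+_ (Σℤ-cong n (λ v → cong b2z (adj10+-vv u v))) (Σℤ-cong m (λ e → cong b2z (adj10+-ve u e))) ⟩
      Σℤ n (λ v → b2z (not ⌊ u ≟ v ⌋)) + Σℤ m (incidence G u)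
    ≡⟨ cong₂ _+_ (Σℤ-offDiagonal n u) (trans (incidence-rowSum G u) (regular u)) ⟩
      + n - + 1 + + r
    ∎
    where open ≡-Reasoning

  degree10+-edge : ∀ e → degree (adj10+ G) (n ↑ʳ e) ≡ + 2
  degree10+-edge e = begin
      degree (adj10+ G) (n ↑ʳ e)
    ≡⟨ Σℤ-↑ n m (λ j → b2z (adj10+ G (n ↑ʳ e) j)) ⟩
      Σℤ n (λ v → b2z (adj10+ G (n ↑ʳ e) (v ↑ˡ m))) + Σℤ m (λ e′ → b2z (adj10+ G (n ↑ʳ e) (n ↑ʳ e′)))
    ≡⟨ cong₂ _+_ (trans (Σℤ-cong n (λ v → cong b2z (adj10+-ev e v))) (incidence-columnSum G e))
                 (Σℤ-zero m (λ e′ → cong b2z (adj10+-ee e e′))) ⟩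
      + 2 + + 0
    ∎
    where open ≡-Reasoning

0-[0+b]≡-b : ∀ b → + 0 - (+ 0 + b) ≡ - b
0-[0+b]≡-b = solve-∀

module _ {n : ℕ} (G : Graph n) (r : ℕ) (regular : IsRegular G r) (x : ℤ) where
  private
    m = edgeCount G

  charMatrix10+-vv : ∀ u v → charMatrix (adj10+ G) x (u ↑ˡ m) (v ↑ˡ m) ≡ δ u v * (x - + r - + n + + 2) - + 1
  charMatrix10+-vv u v
    rewrite ⌊≟⌋≡≡ᵇ (u ↑ˡ m) (v ↑ˡ m) | ↑ˡ-≡ᵇ-↑ˡ m u v | degree10+-vertex G r regular u
          | adj10+-vv G u v | ⌊≟⌋≡≡ᵇ u v
    with u ≡ᵇ v
  ... | true  = diagonal x (+ n) (+ r)
    where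
    diagonal : ∀ x n r → x - (n - + 1 + r + + 0) ≡ + 1 * (x - r - n + + 2) - + 1
    diagonal = solve-∀
  ... | false = refl

  charMatrix10+-ve : ∀ u e → charMatrix (adj10+ G) x (u ↑ˡ m) (n ↑ʳ e) ≡ - incidence G u e
  charMatrix10+-ve u e rewrite ⌊≟⌋≡≡ᵇ (u ↑ˡ m) (n ↑ʳ e) | ↑ˡ-≡ᵇ-↑ʳ m u e | adj10+-ve G u e =
    0-[0+b]≡-b (incidence G u e)

  charMatrix10+-ev : ∀ e v → charMatrix (adj10+ G) x (n ↑ʳ e) (v ↑ˡ m) ≡ - incidence G v e
  charMatrix10+-ev e v rewrite ⌊≟⌋≡≡ᵇ (n ↑ʳ e) (v ↑ˡ m) | ↑ʳ-≡ᵇ-↑ˡ n e v | adj10+-ev G e v =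
    0-[0+b]≡-b (incidence G v e)

  charMatrix10+-ee : ∀ e e′ → charMatrix (adj10+ G) x (n ↑ʳ e) (n ↑ʳ e′) ≡ scalarMatrix (x - + 2) e e′
  charMatrix10+-ee e e′ rewrite ⌊≟⌋≡≡ᵇ (n ↑ʳ e) (n ↑ʳ e′) | ↑ʳ-≡ᵇ-↑ʳ n e e′ | adj10+-ee G e e′
    with e ≡ᵇ e′
  ... | true  rewrite degree10+-edge G e = cong (_+_ x) (ℤ.+-identityʳ (- + 2))
  ... | false = refl

  private
    γ = x - + 2
    μ = (x - + r - + n + + 2) * (x - + 2)
    P = charMatrix (adj10+ G) x
    N = incidence G

    isVertex : Fin (n ℕ.+ m) → Bool
    isVertex i = toℕ i <ᵇ n

    zeros : ∀ {k} → Fin k → ℤ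
    zeros _ = + 0

    vertexRow : Fin n → Fin (n ℕ.+ m) → ℤ
    vertexRow u = zeros ++ N u

    elimination : Matrix (n ℕ.+ m)
    elimination = vertexRow ++ (λ _ → zeros)

    -- Each vertex row times x − 2, plus Σₑ N u e times edge row e: this clears the vertex–edge block.
    reduced : Matrix (n ℕ.+ m)
    reduced i b = if isVertex i then γ * P i b + Σℤ (n ℕ.+ m) (λ l → elimination i l * P l b) else P i b

    elimination-vanishes : ∀ i l → isVertex l ≡ true → elimination i l ≡ + 0
    elimination-vanishes i l isVertex-l with block n m l
    ... | bottom e rewrite ↑ʳ-<ᵇ n e with () ← isVertex-l
    ... | top v with block n m i
    ...   | top u    = trans (cong (λ row → row (v ↑ˡ m)) (lookup-++ˡ vertexRow (λ _ → zeros) u))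
                             (lookup-++ˡ (zeros {n}) (N u) v)
    ...   | bottom e = cong (λ row → row (v ↑ˡ m)) (lookup-++ʳ vertexRow (λ _ → zeros) e)

    elimination-combination : ∀ u b → Σℤ (n ℕ.+ m) (λ l → elimination (u ↑ˡ m) l * P l b)
                                      ≡ Σℤ m (λ e → N u e * P (n ↑ʳ e) b)
    elimination-combination u b = begin
        Σℤ (n ℕ.+ m) (λ l → elimination (u ↑ˡ m) l * P l b)
      ≡⟨ Σℤ-cong (n ℕ.+ m) (λ l → cong (λ row → row l * P l b) (lookup-++ˡ vertexRow (λ _ → zeros) u)) ⟩
        Σℤ (n ℕ.+ m) (λ l → vertexRow u l * P l b)
      ≡⟨ Σℤ-↑ n m (λ l → vertexRow u l * P l b) ⟩
        Σℤ n (λ v → vertexRow u (v ↑ˡ m) * P (v ↑ˡ m) b) + Σℤ m (λ e → vertexRow u (n ↑ʳ e) * P (n ↑ʳ e) b)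
      ≡⟨ cong₂ _+_ (Σℤ-zero n (λ v → trans (cong (_* P (v ↑ˡ m) b) (lookup-++ˡ (zeros {n}) (N u) v))
                                           (ℤ.*-zeroˡ (P (v ↑ˡ m) b))))
                   (Σℤ-cong m (λ e → cong (_* P (n ↑ʳ e) b) (lookup-++ʳ (zeros {n}) (N u) e))) ⟩
        + 0 + Σℤ m (λ e → N u e * P (n ↑ʳ e) b)
      ≡⟨ ℤ.+-identityˡ _ ⟩
        Σℤ m (λ e → N u e * P (n ↑ʳ e) b)
      ∎
      where open ≡-Reasoning

    reduced-vv : ∀ u v → reduced (u ↑ˡ m) (v ↑ˡ m) ≡ charMatrix (adj G) μ u v - γ
    reduced-vv u v rewrite ↑ˡ-<ᵇ m u = begin
        γ * P (u ↑ˡ m) (v ↑ˡ m) + Σℤ (n ℕ.+ m) (λ l → elimination (u ↑ˡ m) l * P l (v ↑ˡ m))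
      ≡⟨ cong₂ _+_ (cong (γ *_) (charMatrix10+-vv u v)) (elimination-combination u (v ↑ˡ m)) ⟩
        γ * (δ u v * (x - + r - + n + + 2) - + 1) + Σℤ m (λ e → N u e * P (n ↑ʳ e) (v ↑ˡ m))
      ≡⟨ cong (_+_ (γ * (δ u v * (x - + r - + n + + 2) - + 1)))
              (trans (Σℤ-cong m (λ e → trans (cong (N u e *_) (charMatrix10+-ev e v))
                                             (sym (ℤ.neg-distribʳ-* (N u e) (N v e)))))
                     (Σℤ-neg m (λ e → N u e * N v e))) ⟩
        γ * (δ u v * (x - + r - + n + + 2) - + 1) - Σℤ m (λ e → N u e * N v e)
      ≡⟨ cong (λ q → γ * (δ u v * (x - + r - + n + + 2) - + 1) - q) (incidence-gram G u v) ⟩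
        γ * (δ u v * (x - + r - + n + + 2) - + 1) - Q (adj G) u v
      ≡⟨ rearrange γ (δ u v) (x - + r - + n + + 2) (Q (adj G) u v) ⟩
        δ u v * μ - Q (adj G) u v - γ
      ≡⟨ cong (λ d → d - Q (adj G) u v - γ) (sym (if-δ u v μ)) ⟩
        charMatrix (adj G) μ u v - γ
      ∎
      where
      open ≡-Reasoning
      rearrange : ∀ g d c q → g * (d * c - + 1) - q ≡ d * (c * g) - q - g
      rearrange = solve-∀

    reduced-ve : ∀ u e → reduced (u ↑ˡ m) (n ↑ʳ e) ≡ + 0
    reduced-ve u e′ rewrite ↑ˡ-<ᵇ m u = begin
        γ * P (u ↑ˡ m) (n ↑ʳ e′) + Σℤ (n ℕ.+ m) (λ l → elimination (u ↑ˡ m) l * P l (n ↑ʳ e′))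
      ≡⟨ cong₂ _+_ (cong (γ *_) (charMatrix10+-ve u e′)) (elimination-combination u (n ↑ʳ e′)) ⟩
        γ * - N u e′ + Σℤ m (λ e → N u e * P (n ↑ʳ e) (n ↑ʳ e′))
      ≡⟨ cong (_+_ (γ * - N u e′))
              (trans (Σℤ-cong m (λ e → trans (cong (N u e *_)
                                                   (trans (charMatrix10+-ee e e′) (scalarMatrix-δ γ e e′)))
                                             (swap (N u e) (δ e e′) γ)))
                     (Σℤ-δʳ m e′ (λ e → N u e * γ))) ⟩
        γ * - N u e′ + N u e′ * γ
      ≡⟨ cancel γ (N u e′) ⟩
        + 0
      ∎
      where
      open ≡-Reasoning
      swap : ∀ a d g → a * (d * g) ≡ d * (a * g)
      swap = solve-∀
      cancel : ∀ g a → g * - a + a * g ≡ + 0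
      cancel = solve-∀

    reduced-ee : ∀ e e′ → reduced (n ↑ʳ e) (n ↑ʳ e′) ≡ scalarMatrix γ e e′
    reduced-ee e e′ rewrite ↑ʳ-<ᵇ n e = charMatrix10+-ee e e′

  charPoly10+-reduction : (x - + 2) ^ n * charPoly (adj10+ G) x
                        ≡ det n (λ u v → charMatrix (adj G) ((x - + r - + n + + 2) * (x - + 2)) u v - (x - + 2))
                          * (x - + 2) ^ edgeCount G
  charPoly10+-reduction = begin
      γ ^ n * det (n ℕ.+ m) P
    ≡⟨ cong (_* det (n ℕ.+ m) P) (sym (Πℤ-prefix n m γ)) ⟩
      Πℤ (n ℕ.+ m) (λ i → if isVertex i then γ else + 1) * det (n ℕ.+ m) P
    ≡⟨ sym (det-rowOperations (n ℕ.+ m) isVertex γ elimination P reduced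
                              elimination-vanishes on-vertices off-vertices) ⟩
      det (n ℕ.+ m) reduced
    ≡⟨ det-blockLowerTriangular n m _ γ reduced reduced-vv reduced-ve reduced-ee ⟩
      det n (λ u v → charMatrix (adj G) μ u v - γ) * γ ^ m
    ∎
    where
    open ≡-Reasoning
    on-vertices : ∀ i → isVertex i ≡ true → ∀ b →
                  reduced i b ≡ γ * P i b + Σℤ (n ℕ.+ m) (λ l → elimination i l * P l b)
    on-vertices i isVertex-i b rewrite isVertex-i = refl
    off-vertices : ∀ i → isVertex i ≡ false → ∀ b → reduced i b ≡ P i b
    off-vertices i ¬isVertex-i b rewrite ¬isVertex-i = refl

split-2n : ∀ r → + (2 ℕ.* r) ≡ + r + + r
split-2n r = trans (ℤ.pos-* 2 r) (double (+ r))
  where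
  double : ∀ a → + 2 * a ≡ a + a
  double = solve-∀

quadratic-factor : ∀ x r n → (x - + r - + n + + 2) * (x - + 2) - + r - + r + + n * - (x - + 2)
                             ≡ (x * x) - (+ (r ℕ.+ 2 ℕ.* n)) * x + + (4 ℕ.* n) - + 4
quadratic-factor x r n =
  trans (expand x (+ r) (+ n))
        (cong₂ (λ a b → x * x - a * x + b - + 4)
               (sym (trans (ℤ.pos-+ r (2 ℕ.* n)) (cong (_+_ (+ r)) (ℤ.pos-* 2 n))))
               (sym (ℤ.pos-* 4 n)))
  where
  expand : ∀ x r n → (x - r - n + + 2) * (x - + 2) - r - r + n * - (x - + 2)
                     ≡ x * x - (r + + 2 * n) * x + + 4 * n - + 4
  expand = solve-∀

mainTheorem9 : (n r : ℕ) (G : Graph n) → 1 ≤ n → IsRegular G r → (x : ℤ) →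
    charPoly (adj10+ G) x
      * (((x - + r - + n + + 2) * (x - + 2)) - + (2 Data.Nat.* r))
      * ((x - + 2) ^ n)
    ≡ ((x * x) - (+ (r Data.Nat.+ 2 Data.Nat.* n)) * x + + (4 Data.Nat.* n) - + 4)
      * ((x - + 2) ^ edgeCount G)
      * charPoly (adj G) ((x - + r - + n + + 2) * (x - + 2))
mainTheorem9 zero     r G () regular x
mainTheorem9 (suc n′) r G _  regular x = begin
    charPoly (adj10+ G) x * (μ - + (2 ℕ.* r)) * γ ^ n
  ≡⟨ cong (λ d → charPoly (adj10+ G) x * (μ - d) * γ ^ n) (split-2n r) ⟩
    charPoly (adj10+ G) x * (μ - (+ r + + r)) * γ ^ n
  ≡⟨ regroup (charPoly (adj10+ G) x) μ (+ r) (γ ^ n) ⟩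
    σ * (γ ^ n * charPoly (adj10+ G) x)
  ≡⟨ cong (σ *_) (charPoly10+-reduction G r regular x) ⟩
    σ * (det n (λ u v → B u v - γ) * γ ^ edgeCount G)
  ≡⟨ sym (ℤ.*-assoc σ (det n (λ u v → B u v - γ)) (γ ^ edgeCount G)) ⟩
    σ * det n (λ u v → B u v - γ) * γ ^ edgeCount G
  ≡⟨ cong (_* γ ^ edgeCount G)
          (det-subtractConstant n′ B γ σ (σ + + n * - γ) (charMatrix-columnSum G r regular μ) shifted-columnSum) ⟩
    (σ + + n * - γ) * det n B * γ ^ edgeCount G
  ≡⟨ cong (λ p → p * det n B * γ ^ edgeCount G) (quadratic-factor x r n) ⟩
    q * det n B * γ ^ edgeCount G
  ≡⟨ swap-last q (det n B) (γ ^ edgeCount G) ⟩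
    q * γ ^ edgeCount G * charPoly (adj G) μ
  ∎
  where
  open ≡-Reasoning
  n = suc n′
  γ μ σ q : ℤ
  γ = x - + 2
  μ = (x - + r - + n + + 2) * (x - + 2)
  σ = μ - + r - + r
  q = (x * x) - (+ (r ℕ.+ 2 ℕ.* n)) * x + + (4 ℕ.* n) - + 4
  B = charMatrix (adj G) μ
  regroup : ∀ c m r g → c * (m - (r + r)) * g ≡ (m - r - r) * (g * c)
  regroup = solve-∀
  swap-last : ∀ a b c → a * b * c ≡ a * c * b
  swap-last = solve-∀
  shifted-columnSum : ∀ b → Σℤ n (λ i → B i b - γ) ≡ σ + + n * - γ
  shifted-columnSum b = trans (Σℤ-+ n (λ i → B i b) (λ _ → - γ))
                              (cong₂ _+_ (charMatrix-columnSum G r regular μ b) (Σℤ-const n (- γ)))
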